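{- Let $\mathbb{F}$ be a field. There is a polynomial $p$ such that for all $n,s\in\mathbb{N}$: if there is a noncommutative arithmetic circuit over $\mathbb{F}$ of size $s$ computing $\mathrm{Cdet}_{2n}(X)$, where $X=\{x_{ij}:1\le i,j\le 2n\}$, then there is a noncommutative arithmetic circuit over $\mathbb{F}$ of size at most $p(s,n)$ computing $\mathrm{Cperm}_n(Y)$, where $Y=\{y_{ij}:1\le i,j\le n\}$.
   Context: All variables are noncommuting. The Cayley determinant and permanent are $\mathrm{Cdet}_n(X)=\sum_{\sigma\in S_n}\mathrm{sgn}(\sigma)\,x_{1,\sigma(1)}x_{2,\sigma(2)}\cdots x_{n,\sigma(n)}$ and $\mathrm{Cperm}_n(X)=\sum_{\sigma\in S_n}x_{1,\sigma(1)}x_{2,\sigma(2)}\cdots x_{n,\sigma(n)}$ (products in the written order). A noncommutative arithmetic circuit over $\mathbb{F}$ is a directed acyclic graph whose leaves are labelled by variables or elements of $\mathbb{F}$ and whose internal nodes are addition or multiplication gates of fan-in two, each multiplication gate having a designated left and right child; gates compute polynomials in the free noncommutative polynomial ring in the natural way (products taken left times right), and the circuit computes the polynomial at a designated output gate. Size is the number of nodes. -}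

module Defs where

open import Level using (Level; _⊔_)
open import Algebra.Bundles using (CommutativeRing)
open import Data.Nat as ℕ using (ℕ; zero; suc; _≤_)
open import Data.Fin as Fin using (Fin; zero; suc; _<?_)
open import Data.Fin.Properties as FinP using ()
open import Data.Product using (Σ; ∃; _×_; _,_; proj₁; proj₂)
open import Data.Product.Properties using (≡-dec)
open import Data.List as List using (List; []; _∷_; _++_; map; concatMap; allFin; foldr)
open import Data.List.Properties as ListP using ()
open import Data.Bool using (Bool; true; false; if_then_else_; _∧_; not)
open import Relation.Nullary using (¬_; Dec; yes; no)
open import Relation.Nullary.Decidable using (⌊_⌋)
open import Relation.Binary.PropositionalEquality using (_≡_; _≢_)

record IsField {c ℓ} (R : CommutativeRing c ℓ) : Set (c ⊔ ℓ) where
  open CommutativeRing R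
  field
    0≉1     : ¬ (0# ≈ 1#)
    inverse : ∀ x → ¬ (x ≈ 0#) → Σ Carrier λ y → x * y ≈ 1#

record Field c ℓ : Set (Level.suc (c ⊔ ℓ)) where
  field
    commRing : CommutativeRing c ℓ
    isField  : IsField commRing
  open CommutativeRing commRing public

Poly2 : Set
Poly2 = List (ℕ × ℕ × ℕ)

eval2 : Poly2 → ℕ → ℕ → ℕ
eval2 p s n = foldr (λ { (a , i , j) acc → a ℕ.* (s ℕ.^ i) ℕ.* (n ℕ.^ j) ℕ.+ acc }) 0 p

module _ {c ℓ} (F : Field c ℓ) where
  open Field F

  -- Noncommutative polynomials over F in variables V (with decidable
  -- equality), represented by their coefficient function on words
  -- (monomials = finite sequences of variables).
  NCPoly : Set → Set c
  NCPoly V = List V → Carrier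

  _≈P_ : ∀ {V} → NCPoly V → NCPoly V → Set ℓ
  p ≈P q = ∀ w → p w ≈ q w

  splits : ∀ {V : Set} → List V → List (List V × List V)
  splits []       = ([] , []) ∷ []
  splits (x ∷ w)  = ([] , x ∷ w) ∷ map (λ { (u , v) → (x ∷ u , v) }) (splits w)

  Σ+ : List Carrier → Carrier
  Σ+ = foldr _+_ 0#

  _⊕_ : ∀ {V} → NCPoly V → NCPoly V → NCPoly V
  (p ⊕ q) w = p w + q w

  _⊗_ : ∀ {V} → NCPoly V → NCPoly V → NCPoly V
  (p ⊗ q) w = Σ+ (map (λ { (u , v) → p u * q v }) (splits w))

  constP : ∀ {V} → Carrier → NCPoly V
  constP a []      = a
  constP a (_ ∷ _) = 0#

  varP : ∀ {V} → ((x y : V) → Dec (x ≡ y)) → V → NCPoly V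
  varP _≟_ x (y ∷ []) with x ≟ y
  ... | yes _ = 1#
  ... | no  _ = 0#
  varP _≟_ x _ = 0#

  -- Noncommutative arithmetic circuits, as DAGs given in topological
  -- order: node k is a leaf (variable or field constant) or an
  -- addition/multiplication gate of fan-in two whose children are among
  -- the nodes 0..k-1 (for mul: left child, right child).

  data Gate (V : Set) (k : ℕ) : Set c where
    var   : V → Gate V k
    const : Carrier → Gate V k
    add   : Fin k → Fin k → Gate V k
    mul   : (left right : Fin k) → Gate V k

  data Nodes (V : Set) : ℕ → Set c where
    []  : Nodes V 0
    _▷_ : ∀ {k} → Nodes V k → Gate V k → Nodes V (suc k)

  record Circuit (V : Set) (size : ℕ) : Set c where
    constructor circuit
    field
      nodes  : Nodes V size
      output : Fin size

  module _ {V : Set} (_≟_ : (x y : V) → Dec (x ≡ y)) where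
    nodeVal : ∀ {k} → Nodes V k → Fin k → NCPoly V
    gateVal : ∀ {k} → Nodes V k → Gate V k → NCPoly V
    nodeVal (ns ▷ g) zero    = gateVal ns g
    nodeVal (ns ▷ g) (suc i) = nodeVal ns i
    gateVal ns (var x)   = varP _≟_ x
    gateVal ns (const a) = constP a
    gateVal ns (add i j) = nodeVal ns i ⊕ nodeVal ns j
    gateVal ns (mul i j) = nodeVal ns i ⊗ nodeVal ns j

    computes : ∀ {s} → Circuit V s → NCPoly V → Set ℓ
    computes C f = nodeVal (Circuit.nodes C) (Circuit.output C) ≈P f

  MVar : ℕ → Set
  MVar m = Fin m × Fin m

  _≟V_ : ∀ {m} → (x y : MVar m) → Dec (x ≡ y)
  _≟V_ = ≡-dec FinP._≟_ FinP._≟_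

  _≟W_ : ∀ {m} → (u v : List (MVar m)) → Dec (u ≡ v)
  _≟W_ = ListP.≡-dec _≟V_

  allFuns : (m k : ℕ) → List (Fin m → Fin k)
  allFuns zero    k = (λ ()) ∷ []
  allFuns (suc m) k =
    concatMap (λ f → map (λ j → λ { zero → j ; (suc i) → f i }) (allFin k)) (allFuns m k)

  pairs : (m : ℕ) → List (Fin m × Fin m)
  pairs m = concatMap (λ i → concatMap (λ j → if ⌊ i <? j ⌋ then (i , j) ∷ [] else []) (allFin m)) (allFin m)

  isPerm : ∀ {m} → (Fin m → Fin m) → Bool
  isPerm {m} σ = foldr (λ { (i , j) b → not ⌊ σ i FinP.≟ σ j ⌋ ∧ b }) true (pairs m)

  oddPerm : ∀ {m} → (Fin m → Fin m) → Bool
  oddPerm {m} σ = foldr (λ { (i , j) b → if ⌊ σ j <? σ i ⌋ then not b else b }) false (pairs m)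

  sgn : ∀ {m} → (Fin m → Fin m) → Carrier
  sgn σ = if oddPerm σ then - 1# else 1#

  monomial : ∀ {m} → (Fin m → Fin m) → List (MVar m)
  monomial {m} σ = map (λ i → (i , σ i)) (allFin m)

  indicator : ∀ {m} → List (MVar m) → List (MVar m) → Carrier
  indicator u w with u ≟W w
  ... | yes _ = 1#
  ... | no  _ = 0#

  Cdet : (m : ℕ) → NCPoly (MVar m)
  Cdet m w = Σ+ (map (λ σ → if isPerm σ then sgn σ * indicator (monomial σ) w else 0#) (allFuns m m))

  Cperm : (m : ℕ) → NCPoly (MVar m)
  Cperm m w = Σ+ (map (λ σ → if isPerm σ then indicator (monomial σ) w else 0#) (allFuns m m))

module Submission where

-- Let doubleWord w replace each letter y_{ia} of w by x_{2i,2a} x_{2i+1,2a+1} (indices from 0).  The coefficient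
-- of Cdet_{2n} at doubleWord w is that of Cperm_n at w: such a word is a monomial of Cdet_{2n} exactly when it comes
-- from a doubled permutation π ⊗ id₂, and doubling a permutation quadruples its inversions, so every sign is +1.
-- The map f ↦ f ∘ doubleWord is linear but not multiplicative.  It is the (idle , idle) entry of the matrix
-- (project s t f) indexed by the n² + 1 states of the automaton that reads x_{2i,2a} x_{2i+1,2a+1} as y_{ia},
-- and this matrix is multiplicative: project (f g) is the matrix product of project f and project g.  Computing
-- all entries gate by gate turns a circuit of size s for Cdet_{2n} into one of size O(s n⁶) for Cperm_n.

open import Level using (_⊔_)
open import Data.Bool using (Bool; true; false; if_then_else_; _∧_; not; _xor_)
open import Data.Bool.Properties using (not-distribˡ-xor; xor-same; ⇔→≡)
open import Data.Empty using (⊥-elim)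
open import Data.Fin as Fin using (Fin; zero; suc; _<?_)
import Data.Fin.Properties as FinP
open import Data.List as List using (List; []; _∷_; _++_; map; concatMap; allFin; foldr; tabulate)
import Data.List.Properties as ListP
open import Data.Nat as ℕ using (ℕ; zero; suc; _≤_; z≤n; s≤s)
import Data.Nat.Properties as ℕP
open import Data.Nat.Tactic.RingSolver using (solve-∀)
open import Data.Product using (Σ; ∃; _×_; _,_; proj₁; proj₂)
open import Data.Sum using (_⊎_; inj₁; inj₂)
open import Data.List.Membership.Propositional using (_∈_)
import Data.List.Membership.Propositional.Properties as ∈P
open import Data.List.Relation.Unary.Any as Any using (here; there)
import Data.Vec.Functional as V
open import Function using (_∘_; mk⇔)
open import Function.Definitions using (Injective)
open import Relation.Binary.Definitions using (DecidableEquality)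
open import Relation.Nullary using (¬_; Dec; yes; no; does)
open import Relation.Nullary.Decidable using (⌊_⌋; isYes≗does; does-⇔)
open import Relation.Binary.PropositionalEquality as ≡ using (_≡_; _≢_; refl; cong; cong₂)

open import Defs hiding (_⊗_; _⊕_)
import Defs

⌊⌋-true : ∀ {P : Set} (d : Dec P) → P → ⌊ d ⌋ ≡ true
⌊⌋-true (yes _) _ = refl
⌊⌋-true (no ¬p) p = ⊥-elim (¬p p)

⌊⌋-false : ∀ {P : Set} (d : Dec P) → ¬ P → ⌊ d ⌋ ≡ false
⌊⌋-false (yes p) ¬p = ⊥-elim (¬p p)
⌊⌋-false (no _)  _  = refl

<?-suc : ∀ {n} (i j : Fin n) → ⌊ suc i <? suc j ⌋ ≡ ⌊ i <? j ⌋
<?-suc i j = ≡.trans (isYes≗does _)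
  (≡.trans (does-⇔ (mk⇔ ℕ.s<s⁻¹ ℕ.s<s) (suc i <? suc j) (i <? j)) (≡.sym (isYes≗does _)))

double : ℕ → ℕ
double zero    = zero
double (suc n) = suc (suc (double n))

double≡2* : ∀ n → 2 ℕ.* n ≡ double n
double≡2* zero    = refl
double≡2* (suc n) = ≡.trans (ℕP.*-distribˡ-+ 2 1 n) (cong (λ k → suc (suc k)) (double≡2* n))

even odd : ∀ {n} → Fin n → Fin (double n)
even zero    = zero
even (suc i) = suc (suc (even i))
odd zero     = suc zero
odd (suc i)  = suc (suc (odd i))

even-injective : ∀ {n} → Injective {A = Fin n} _≡_ _≡_ even
even-injective {x = zero}  {zero}  _ = refl
even-injective {x = suc i} {suc j} e = cong suc (even-injective (FinP.suc-injective (FinP.suc-injective e)))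

odd-injective : ∀ {n} → Injective {A = Fin n} _≡_ _≡_ odd
odd-injective {x = zero}  {zero}  _ = refl
odd-injective {x = suc i} {suc j} e = cong suc (odd-injective (FinP.suc-injective (FinP.suc-injective e)))

even≢odd : ∀ {n} (i j : Fin n) → even i ≢ odd j
even≢odd zero    zero    ()
even≢odd zero    (suc j) ()
even≢odd (suc i) zero    ()
even≢odd (suc i) (suc j) e = even≢odd i j (FinP.suc-injective (FinP.suc-injective e))

even-or-odd : ∀ {n} (x : Fin (double n)) → ∃ λ l → x ≡ even l ⊎ x ≡ odd l
even-or-odd {suc n} zero          = zero , inj₁ refl
even-or-odd {suc n} (suc zero)    = zero , inj₂ refl
even-or-odd {suc n} (suc (suc x)) with even-or-odd {n} x
... | l , inj₁ refl = suc l , inj₁ refl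
... | l , inj₂ refl = suc l , inj₂ refl

<?-even≡<?-odd : ∀ {N} (z : Fin (double N)) (x : Fin N) → z ≢ even x → ⌊ z <? even x ⌋ ≡ ⌊ z <? odd x ⌋
<?-even≡<?-odd {suc N} zero          zero    z≢ = ⊥-elim (z≢ refl)
<?-even≡<?-odd {suc N} (suc z)       zero    z≢ = ≡.sym (<?-suc z zero)
<?-even≡<?-odd {suc N} zero          (suc x) z≢ = refl
<?-even≡<?-odd {suc N} (suc zero)    (suc x) z≢ = refl
<?-even≡<?-odd {suc N} (suc (suc z)) (suc x) z≢ = begin
  ⌊ suc (suc z) <? suc (suc (even x)) ⌋ ≡⟨ ≡.trans (<?-suc (suc z) _) (<?-suc z _) ⟩
  ⌊ z <? even x ⌋                       ≡⟨ <?-even≡<?-odd z x (z≢ ∘ cong (λ y → suc (suc y))) ⟩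
  ⌊ z <? odd x ⌋                        ≡⟨ ≡.sym (≡.trans (<?-suc (suc z) _) (<?-suc z _)) ⟩
  ⌊ suc (suc z) <? suc (suc (odd x)) ⌋  ∎
  where open ≡.≡-Reasoning

odd<?even : ∀ {N} (x : Fin N) → ⌊ odd x <? even x ⌋ ≡ false
odd<?even zero    = refl
odd<?even (suc x) = ≡.trans (<?-suc (suc (odd x)) _) (≡.trans (<?-suc (odd x) _) (odd<?even x))

doubleMap : ∀ {n N} → (Fin n → Fin N) → Fin (double n) → Fin (double N)
doubleMap {suc n} π zero          = even (π zero)
doubleMap {suc n} π (suc zero)    = odd (π zero)
doubleMap {suc n} π (suc (suc x)) = doubleMap (V.tail π) x

doubleMap-even : ∀ {n N} (π : Fin n → Fin N) i → doubleMap π (even i) ≡ even (π i)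
doubleMap-even π zero    = refl
doubleMap-even π (suc i) = doubleMap-even (V.tail π) i

doubleMap-odd : ∀ {n N} (π : Fin n → Fin N) i → doubleMap π (odd i) ≡ odd (π i)
doubleMap-odd π zero    = refl
doubleMap-odd π (suc i) = doubleMap-odd (V.tail π) i

doubleMap-injective : ∀ {n N} (π : Fin n → Fin N) →
  Injective _≡_ _≡_ π → Injective _≡_ _≡_ (doubleMap π)
doubleMap-injective π inj {x} {y} e with even-or-odd x | even-or-odd y
... | l , inj₁ refl | l′ , inj₁ refl =
  cong even (inj (even-injective (≡.trans (≡.sym (doubleMap-even π l)) (≡.trans e (doubleMap-even π l′)))))
... | l , inj₂ refl | l′ , inj₂ refl =
  cong odd (inj (odd-injective (≡.trans (≡.sym (doubleMap-odd π l)) (≡.trans e (doubleMap-odd π l′)))))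
... | l , inj₁ refl | l′ , inj₂ refl =
  ⊥-elim (even≢odd (π l) (π l′) (≡.trans (≡.sym (doubleMap-even π l)) (≡.trans e (doubleMap-odd π l′))))
... | l , inj₂ refl | l′ , inj₁ refl =
  ⊥-elim (even≢odd (π l′) (π l) (≡.trans (≡.sym (doubleMap-even π l′)) (≡.trans (≡.sym e) (doubleMap-odd π l))))

doubleMap-injective⁻ : ∀ {n N} (π : Fin n → Fin N) →
  Injective _≡_ _≡_ (doubleMap π) → Injective _≡_ _≡_ π
doubleMap-injective⁻ π inj {i} {j} e =
  even-injective (inj (≡.trans (doubleMap-even π i) (≡.trans (cong even e) (≡.sym (doubleMap-even π j)))))

doubleWord : ∀ {N} → List (Fin N × Fin N) → List (Fin (double N) × Fin (double N))
doubleWord []            = []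
doubleWord ((i , a) ∷ w) = (even i , even a) ∷ (odd i , odd a) ∷ doubleWord w

foldrFin : ∀ {a} {A : Set a} m → (Fin m → A → A) → A → A
foldrFin zero    h z = z
foldrFin (suc m) h z = h zero (foldrFin m (h ∘ suc) z)

foldr-tabulate : ∀ {a b} {A : Set a} {B : Set b} m (g : Fin m → B) (f : B → A → A) z →
  foldr f z (tabulate g) ≡ foldrFin m (f ∘ g) z
foldr-tabulate zero    g f z = refl
foldr-tabulate (suc m) g f z = cong (f (g zero)) (foldr-tabulate m (g ∘ suc) f z)

foldrFin-cong : ∀ {a} {A : Set a} m {f g : Fin m → A → A} z →
  (∀ j x → f j x ≡ g j x) → foldrFin m f z ≡ foldrFin m g z
foldrFin-cong zero    z e = refl
foldrFin-cong (suc m) {g = g} z e = ≡.trans (e zero _) (cong (g zero) (foldrFin-cong m z (e ∘ suc)))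

foldrFin-∧-true⁻ : ∀ m (t : Fin m → Bool) z →
  foldrFin m (λ j b → t j ∧ b) z ≡ true → (∀ j → t j ≡ true) × z ≡ true
foldrFin-∧-true⁻ zero    t z e = (λ ()) , e
foldrFin-∧-true⁻ (suc m) t z e with t zero in t₀ | e
... | false | ()
... | true  | e′ = let ts , z≡true = foldrFin-∧-true⁻ m (t ∘ suc) z e′
                   in (λ { zero → t₀ ; (suc j) → ts j }) , z≡true

foldrFin-∧-true : ∀ m (t : Fin m → Bool) z →
  (∀ j → t j ≡ true) → z ≡ true → foldrFin m (λ j b → t j ∧ b) z ≡ true
foldrFin-∧-true zero    t z ts e = e
foldrFin-∧-true (suc m) t z ts e = cong₂ _∧_ (ts zero) (foldrFin-∧-true m (t ∘ suc) z (ts ∘ suc) e)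

toggle : ∀ {m} → (Fin m → Bool) → Fin m → Bool → Bool
toggle t j b = if t j then not b else b

foldrFin-toggle : ∀ m (t : Fin m → Bool) z → foldrFin m (toggle t) z ≡ foldrFin m (toggle t) false xor z
foldrFin-toggle zero    t z = refl
foldrFin-toggle (suc m) t z with t zero
... | true  = ≡.trans (cong not (foldrFin-toggle m (t ∘ suc) z))
                      (not-distribˡ-xor (foldrFin m (toggle (t ∘ suc)) false) z)
... | false = foldrFin-toggle m (t ∘ suc) z

foldrFin-toggle-twice : ∀ m (t t′ : Fin m → Bool) → (∀ j → t j ≡ t′ j) →
  foldrFin m (toggle t) (foldrFin m (toggle t′) false) ≡ false
foldrFin-toggle-twice m t t′ t≗t′ = begin
  foldrFin m (toggle t) (foldrFin m (toggle t′) false)       ≡⟨ foldrFin-toggle m t _ ⟩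
  foldrFin m (toggle t) false xor foldrFin m (toggle t′) false
    ≡⟨ cong (foldrFin m (toggle t) false xor_)
            (foldrFin-cong m false (λ j b → cong (λ s → if s then not b else b) (≡.sym (t≗t′ j)))) ⟩
  foldrFin m (toggle t) false xor foldrFin m (toggle t) false ≡⟨ xor-same (foldrFin m (toggle t) false) ⟩
  false                                                        ∎
  where open ≡.≡-Reasoning

module Sums {c ℓ} (F : Field c ℓ) where
  open Field F hiding (zero) renaming (refl to ≈-refl; sym to ≈-sym; trans to ≈-trans)
  open import Relation.Binary.Reasoning.Setoid setoid

  sum : List Carrier → Carrier
  sum = Σ+ F

  sum-++ : ∀ xs ys → sum (xs ++ ys) ≈ sum xs + sum ys
  sum-++ []       ys = ≈-sym (+-identityˡ _)
  sum-++ (x ∷ xs) ys = ≈-trans (+-cong ≈-refl (sum-++ xs ys)) (≈-sym (+-assoc _ _ _))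

  module _ {A : Set} where
    sum-map-cong : ∀ {f g : A → Carrier} l → (∀ x → f x ≈ g x) → sum (map f l) ≈ sum (map g l)
    sum-map-cong []      f≈g = ≈-refl
    sum-map-cong (x ∷ l) f≈g = +-cong (f≈g x) (sum-map-cong l f≈g)

    sum-map-zero : ∀ {f : A → Carrier} l → (∀ x → f x ≈ 0#) → sum (map f l) ≈ 0#
    sum-map-zero []      f≈0 = ≈-refl
    sum-map-zero (x ∷ l) f≈0 = ≈-trans (+-cong (f≈0 x) (sum-map-zero l f≈0)) (+-identityˡ 0#)

    sum-map-+ : ∀ (f g : A → Carrier) l → sum (map (λ x → f x + g x) l) ≈ sum (map f l) + sum (map g l)
    sum-map-+ f g []      = ≈-sym (+-identityˡ 0#)
    sum-map-+ f g (x ∷ l) = begin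
      (f x + g x) + sum (map (λ x → f x + g x) l)      ≈⟨ +-cong ≈-refl (sum-map-+ f g l) ⟩
      (f x + g x) + (sum (map f l) + sum (map g l))    ≈⟨ +-assoc (f x) (g x) _ ⟩
      f x + (g x + (sum (map f l) + sum (map g l)))    ≈⟨ +-cong ≈-refl (≈-sym (+-assoc (g x) _ _)) ⟩
      f x + ((g x + sum (map f l)) + sum (map g l))    ≈⟨ +-cong ≈-refl (+-cong (+-comm (g x) _) ≈-refl) ⟩
      f x + ((sum (map f l) + g x) + sum (map g l))    ≈⟨ +-cong ≈-refl (+-assoc _ (g x) _) ⟩
      f x + (sum (map f l) + (g x + sum (map g l)))    ≈⟨ ≈-sym (+-assoc (f x) _ _) ⟩
      (f x + sum (map f l)) + (g x + sum (map g l))    ∎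

  sum-map-∘ : ∀ {A B : Set} {f : B → Carrier} {g : A → B} {h : A → Carrier} l →
    (∀ x → f (g x) ≡ h x) → sum (map f (map g l)) ≈ sum (map h l)
  sum-map-∘ []      e = ≈-refl
  sum-map-∘ (x ∷ l) e = +-cong (reflexive (e x)) (sum-map-∘ l e)

  sum-concatMap : ∀ {A B : Set} (g : B → Carrier) (f : A → List B) l →
    sum (map g (concatMap f l)) ≈ sum (map (λ x → sum (map g (f x))) l)
  sum-concatMap g f []      = ≈-refl
  sum-concatMap g f (x ∷ l) = begin
    sum (map g (f x ++ concatMap f l))                  ≡⟨ cong sum (ListP.map-++ g (f x) (concatMap f l)) ⟩
    sum (map g (f x) ++ map g (concatMap f l))          ≈⟨ sum-++ (map g (f x)) _ ⟩
    sum (map g (f x)) + sum (map g (concatMap f l))     ≈⟨ +-cong ≈-refl (sum-concatMap g f l) ⟩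
    sum (map g (f x)) + sum (map (λ x → sum (map g (f x))) l) ∎

  sumFin : ∀ n → (Fin n → Carrier) → Carrier
  sumFin n h = sum (map h (allFin n))

  sumFin-suc : ∀ n h → sumFin (suc n) h ≈ h zero + sumFin n (h ∘ suc)
  sumFin-suc n h = +-cong ≈-refl (reflexive (cong sum
    (≡.trans (ListP.map-tabulate suc h) (≡.sym (ListP.map-tabulate (λ j → j) (h ∘ suc))))))

  [_]*_ : ∀ {P : Set} → Dec P → Carrier → Carrier
  [ d ]* v = if does d then v else 0#

  module _ {P : Set} where
    []*-cong : ∀ (d : Dec P) {x y} → x ≈ y → [ d ]* x ≈ [ d ]* y
    []*-cong (yes _) x≈y = x≈y
    []*-cong (no  _) _   = ≈-refl

    []*-zero : ∀ (d : Dec P) {x} → x ≈ 0# → [ d ]* x ≈ 0#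
    []*-zero (yes _) x≈0 = x≈0
    []*-zero (no  _) _   = ≈-refl

    []*-yes : ∀ (d : Dec P) {x} → P → [ d ]* x ≈ x
    []*-yes (yes _) p = ≈-refl
    []*-yes (no ¬p) p = ⊥-elim (¬p p)

    []*-no : ∀ (d : Dec P) {x} → ¬ P → [ d ]* x ≈ 0#
    []*-no (yes p) ¬p = ⊥-elim (¬p p)
    []*-no (no  _) ¬p = ≈-refl

    []*-+ : ∀ (d : Dec P) x y → [ d ]* (x + y) ≈ [ d ]* x + [ d ]* y
    []*-+ (yes _) x y = ≈-refl
    []*-+ (no  _) x y = ≈-sym (+-identityˡ 0#)

    []*-*ˡ : ∀ (d : Dec P) k x → [ d ]* (k * x) ≈ k * [ d ]* x
    []*-*ˡ (yes _) k x = ≈-refl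
    []*-*ˡ (no  _) k x = ≈-sym (zeroʳ k)

    []*-*ʳ : ∀ (d : Dec P) x k → [ d ]* (x * k) ≈ [ d ]* x * k
    []*-*ʳ (yes _) x k = ≈-refl
    []*-*ʳ (no  _) x k = ≈-sym (zeroˡ k)

    sum-map-[]* : ∀ (d : Dec P) {A : Set} (f : A → Carrier) l →
      sum (map (λ x → [ d ]* f x) l) ≈ [ d ]* sum (map f l)
    sum-map-[]* (yes _) f l = ≈-refl
    sum-map-[]* (no  _) f l = sum-map-zero l (λ _ → ≈-refl)

  sumFin-[≟]*ˡ : ∀ n (i : Fin n) (h : Fin n → Carrier) → sumFin n (λ j → [ j FinP.≟ i ]* h j) ≈ h i
  sumFin-[≟]*ˡ (suc n) zero h =
    ≈-trans (sumFin-suc n _) (≈-trans (+-cong ≈-refl (sum-map-zero (allFin n) (λ _ → ≈-refl))) (+-identityʳ _))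
  sumFin-[≟]*ˡ (suc n) (suc i) h =
    ≈-trans (sumFin-suc n _) (≈-trans (+-identityˡ _) (sumFin-[≟]*ˡ n i (h ∘ suc)))

  sumFin-[≟]*ʳ : ∀ n (i : Fin n) (h : Fin n → Carrier) → sumFin n (λ j → [ i FinP.≟ j ]* h j) ≈ h i
  sumFin-[≟]*ʳ (suc n) zero h =
    ≈-trans (sumFin-suc n _) (≈-trans (+-cong ≈-refl (sum-map-zero (allFin n) (λ _ → ≈-refl))) (+-identityʳ _))
  sumFin-[≟]*ʳ (suc n) (suc i) h =
    ≈-trans (sumFin-suc n _) (≈-trans (+-identityˡ _) (sumFin-[≟]*ʳ n i (h ∘ suc)))

  sumFin²-[≟]*ˡ : ∀ n (i a : Fin n) (h : Fin n → Fin n → Carrier) →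
    sumFin n (λ j → sumFin n (λ c → [ j FinP.≟ i ]* [ c FinP.≟ a ]* h j c)) ≈ h i a
  sumFin²-[≟]*ˡ n i a h = ≈-trans
    (sum-map-cong (allFin n) (λ j → ≈-trans (sum-map-[]* (j FinP.≟ i) _ (allFin n))
                                            ([]*-cong (j FinP.≟ i) (sumFin-[≟]*ˡ n a (h j)))))
    (sumFin-[≟]*ˡ n i (λ j → h j a))

  sumFin²-[≟]*ʳ : ∀ n (i a : Fin n) (h : Fin n → Fin n → Carrier) →
    sumFin n (λ j → sumFin n (λ c → [ i FinP.≟ j ]* [ a FinP.≟ c ]* h j c)) ≈ h i a
  sumFin²-[≟]*ʳ n i a h = ≈-trans
    (sum-map-cong (allFin n) (λ j → ≈-trans (sum-map-[]* (i FinP.≟ j) _ (allFin n))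
                                            ([]*-cong (i FinP.≟ j) (sumFin-[≟]*ʳ n a (h j)))))
    (sumFin-[≟]*ʳ n i (λ j → h j a))

  sumFin²-zero : ∀ n (h : Fin n → Fin n → Carrier) → (∀ j c → h j c ≈ 0#) →
    sumFin n (λ j → sumFin n (h j)) ≈ 0#
  sumFin²-zero n h h≈0 = sum-map-zero (allFin n) (λ j → sum-map-zero (allFin n) (h≈0 j))

module NCPolynomials {c ℓ} (F : Field c ℓ) where
  open Field F hiding (zero) renaming (refl to ≈-refl; sym to ≈-sym; trans to ≈-trans)
  open Sums F

  module _ {V : Set} where
    infixl 6 _⊕_
    infixl 7 _⊗_
    infixr 7 _·_

    _⊕_ _⊗_ : NCPoly F V → NCPoly F V → NCPoly F V
    _⊕_ = Defs._⊕_ F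
    _⊗_ = Defs._⊗_ F

    _·_ : Carrier → NCPoly F V → NCPoly F V
    (k · f) w = k * f w

    ∂ : V → NCPoly F V → NCPoly F V
    ∂ x f u = f (x ∷ u)

    ⊗-[] : ∀ p q → (p ⊗ q) [] ≈ p [] * q []
    ⊗-[] p q = +-identityʳ _

    ⊗-∷ : ∀ p q x u → (p ⊗ q) (x ∷ u) ≈ p [] * q (x ∷ u) + (∂ x p ⊗ q) u
    ⊗-∷ p q x u = +-cong ≈-refl (sum-map-∘ (splits F u) (λ _ → refl))

    ⊗-cong : ∀ {p p′ q q′} → _≈P_ F p p′ → _≈P_ F q q′ → _≈P_ F (p ⊗ q) (p′ ⊗ q′)
    ⊗-cong p≈p′ q≈q′ w = sum-map-cong (splits F w) (λ (u , v) → *-cong (p≈p′ u) (q≈q′ v))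

    ⊗-zeroˡ : ∀ {p} q → (∀ u → p u ≈ 0#) → ∀ w → (p ⊗ q) w ≈ 0#
    ⊗-zeroˡ q p≈0 w = sum-map-zero (splits F w) (λ (u , v) → ≈-trans (*-cong (p≈0 u) ≈-refl) (zeroˡ _))

    ⊗-[]*ˡ : ∀ {P : Set} (d : Dec P) p q w → ((λ u → [ d ]* p u) ⊗ q) w ≈ [ d ]* (p ⊗ q) w
    ⊗-[]*ˡ (yes _) p q w = ≈-refl
    ⊗-[]*ˡ (no  _) p q w = ⊗-zeroˡ q (λ _ → ≈-refl) w

module Inversions {c ℓ} (F : Field c ℓ) where
  open ≡.≡-Reasoning

  private
    pairIf : ∀ {m} → Fin m → Fin m → List (Fin m × Fin m)
    pairIf i j = if ⌊ i <? j ⌋ then (i , j) ∷ [] else []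

    shift : ∀ {m} → Fin m × Fin m → Fin (suc m) × Fin (suc m)
    shift (i , j) = suc i , suc j

    pairIf-suc : ∀ {m} (i j : Fin m) → pairIf (suc i) (suc j) ≡ map shift (pairIf i j)
    pairIf-suc i j rewrite <?-suc i j with ⌊ i <? j ⌋
    ... | true  = refl
    ... | false = refl

    row-zero : ∀ {m} k (h : Fin k → Fin m) →
      concatMap (pairIf zero) (tabulate (suc ∘ h)) ≡ tabulate (λ x → zero , suc (h x))
    row-zero zero    h = refl
    row-zero (suc k) h = cong ((zero , suc (h zero)) ∷_) (row-zero k (h ∘ suc))

    row-suc : ∀ {m} k (i : Fin m) (h : Fin k → Fin m) →
      concatMap (pairIf (suc i)) (tabulate (suc ∘ h)) ≡ map shift (concatMap (pairIf i) (tabulate h))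
    row-suc zero    i h = refl
    row-suc (suc k) i h =
      ≡.trans (cong₂ _++_ (pairIf-suc i (h zero)) (row-suc k i (h ∘ suc)))
              (≡.sym (ListP.map-++ shift (pairIf i (h zero)) _))

    rows-suc : ∀ {m} k (h : Fin k → Fin m) →
      concatMap (λ i → concatMap (pairIf i) (allFin (suc m))) (tabulate (suc ∘ h)) ≡
      map shift (concatMap (λ i → concatMap (pairIf i) (allFin m)) (tabulate h))
    rows-suc         zero    h = refl
    rows-suc {m = m} (suc k) h =
      ≡.trans (cong₂ _++_ (row-suc m (h zero) (λ j → j)) (rows-suc k (h ∘ suc)))
              (≡.sym (ListP.map-++ shift (concatMap (pairIf (h zero)) (allFin m)) _))

  pairs-suc : ∀ m → pairs F (suc m) ≡ tabulate (λ j → zero , suc j) ++ map shift (pairs F m)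
  pairs-suc m = cong₂ _++_ (row-zero m (λ j → j)) (rows-suc m (λ j → j))

  module _ {m k : ℕ} (σ : Fin m → Fin k) where
    distinctStep parityStep : Fin m × Fin m → Bool → Bool
    distinctStep (i , j) b = not ⌊ σ i FinP.≟ σ j ⌋ ∧ b
    parityStep   (i , j) b = if ⌊ σ j <? σ i ⌋ then not b else b

    allDistinct inversionParity : Bool
    allDistinct     = foldr distinctStep true  (pairs F m)
    inversionParity = foldr parityStep   false (pairs F m)

  isPerm≡allDistinct : ∀ {m} (σ : Fin m → Fin m) → isPerm F σ ≡ allDistinct σ
  isPerm≡allDistinct {m} σ = ListP.foldr-cong {f = λ { (i , j) b → not ⌊ σ i FinP.≟ σ j ⌋ ∧ b }}
    {g = distinctStep σ} (λ _ _ → refl) refl (pairs F m)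

  oddPerm≡inversionParity : ∀ {m} (σ : Fin m → Fin m) → oddPerm F σ ≡ inversionParity σ
  oddPerm≡inversionParity {m} σ = ListP.foldr-cong {f = λ { (i , j) b → if ⌊ σ j <? σ i ⌋ then not b else b }}
    {g = parityStep σ} (λ _ _ → refl) refl (pairs F m)

  allDistinct-cong : ∀ {m k} {σ σ′ : Fin m → Fin k} → (∀ i → σ i ≡ σ′ i) → allDistinct σ ≡ allDistinct σ′
  allDistinct-cong {m} {σ = σ} {σ′} σ≗σ′ = ListP.foldr-cong {f = distinctStep σ} {g = distinctStep σ′}
    (λ (i , j) b → cong (λ z → not z ∧ b) (cong₂ (λ u v → ⌊ u FinP.≟ v ⌋) (σ≗σ′ i) (σ≗σ′ j))) refl
    (pairs F m)

  inversionParity-cong : ∀ {m k} {σ σ′ : Fin m → Fin k} → (∀ i → σ i ≡ σ′ i) →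
    inversionParity σ ≡ inversionParity σ′
  inversionParity-cong {m} {σ = σ} {σ′} σ≗σ′ = ListP.foldr-cong {f = parityStep σ} {g = parityStep σ′}
    (λ (i , j) b → cong (λ z → if z then not b else b) (cong₂ (λ u v → ⌊ u <? v ⌋) (σ≗σ′ j) (σ≗σ′ i))) refl
    (pairs F m)

  foldr-pairs-suc : ∀ m {A : Set} (f : Fin (suc m) × Fin (suc m) → A → A) z →
    foldr f z (pairs F (suc m)) ≡ foldrFin m (λ j → f (zero , suc j)) (foldr (f ∘ shift) z (pairs F m))
  foldr-pairs-suc m f z = begin
    foldr f z (pairs F (suc m))                                          ≡⟨ cong (foldr f z) (pairs-suc m) ⟩
    foldr f z (tabulate (λ j → zero , suc j) ++ map shift (pairs F m))
      ≡⟨ ListP.foldr-++ f z (tabulate (λ j → zero , suc j)) (map shift (pairs F m)) ⟩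
    foldr f (foldr f z (map shift (pairs F m))) (tabulate (λ j → zero , suc j))
      ≡⟨ cong (λ y → foldr f y (tabulate (λ j → zero , suc j))) (ListP.foldr-map f shift z (pairs F m)) ⟩
    foldr f (foldr (f ∘ shift) z (pairs F m)) (tabulate (λ j → zero , suc j))
      ≡⟨ foldr-tabulate m (λ j → zero , suc j) f _ ⟩
    foldrFin m (λ j → f (zero , suc j)) (foldr (f ∘ shift) z (pairs F m)) ∎

  module _ {m k : ℕ} (σ : Fin (suc m) → Fin k) where
    allDistinct-suc : allDistinct σ ≡
      foldrFin m (λ j b → not ⌊ σ zero FinP.≟ σ (suc j) ⌋ ∧ b) (allDistinct (σ ∘ suc))
    allDistinct-suc = foldr-pairs-suc m (distinctStep σ) true

    inversionParity-suc : inversionParity σ ≡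
      foldrFin m (toggle (λ j → ⌊ σ (suc j) <? σ zero ⌋)) (inversionParity (σ ∘ suc))
    inversionParity-suc = foldr-pairs-suc m (parityStep σ) false

  allDistinct⇒injective : ∀ m {k} (σ : Fin m → Fin k) → allDistinct σ ≡ true → Injective _≡_ _≡_ σ
  allDistinct⇒injective (suc m) σ distinct {i} {j} σi≡σj
    with foldrFin-∧-true⁻ m _ _ (≡.trans (≡.sym (allDistinct-suc σ)) distinct)
  ... | σ₀-fresh , distinct-tail = injective i j σi≡σj
    where
    σ₀≢ : ∀ j → σ zero ≢ σ (suc j)
    σ₀≢ j e with ≡.trans (≡.sym (σ₀-fresh j)) (cong not (⌊⌋-true (σ zero FinP.≟ σ (suc j)) e))
    ... | ()
    injective : ∀ i j → σ i ≡ σ j → i ≡ j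
    injective zero    zero    _ = refl
    injective zero    (suc j) e = ⊥-elim (σ₀≢ j e)
    injective (suc i) zero    e = ⊥-elim (σ₀≢ i (≡.sym e))
    injective (suc i) (suc j) e = cong suc (allDistinct⇒injective m (σ ∘ suc) distinct-tail e)

  injective⇒allDistinct : ∀ m {k} (σ : Fin m → Fin k) → Injective _≡_ _≡_ σ → allDistinct σ ≡ true
  injective⇒allDistinct zero    σ inj = refl
  injective⇒allDistinct (suc m) σ inj = ≡.trans (allDistinct-suc σ) (foldrFin-∧-true m _ _
    (λ j → cong not (⌊⌋-false (σ zero FinP.≟ σ (suc j)) (λ e → zero≢suc (inj e))))
    (injective⇒allDistinct m (σ ∘ suc) (FinP.suc-injective ∘ inj)))
    where
    zero≢suc : ∀ {j : Fin m} → Fin.zero ≢ suc j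
    zero≢suc ()

  allDistinct-doubleMap : ∀ {n N} (π : Fin n → Fin N) → allDistinct (doubleMap π) ≡ allDistinct π
  allDistinct-doubleMap {n} π = ⇔→≡ {z = true} (mk⇔
    (λ e → injective⇒allDistinct n π (doubleMap-injective⁻ π (allDistinct⇒injective (double n) (doubleMap π) e)))
    (λ e → injective⇒allDistinct (double n) (doubleMap π) (doubleMap-injective π (allDistinct⇒injective n π e))))

  -- Rows 2i and 2i+1 of π ⊗ id₂ meet the other rows in the same inversions, so their toggles cancel,
  -- and they are not inverted with each other.
  inversionParity-doubleMap : ∀ n {N} (π : Fin n → Fin N) → Injective _≡_ _≡_ π →
    inversionParity (doubleMap π) ≡ false
  inversionParity-doubleMap zero    π inj = refl
  inversionParity-doubleMap (suc n) {N} π inj = begin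
    inversionParity τ
      ≡⟨ inversionParity-suc τ ⟩
    toggle t₀ zero (foldrFin (double n) (toggle (t₀ ∘ suc)) (inversionParity (τ ∘ suc)))
      ≡⟨ cong (λ b → if b then not rest else rest) (odd<?even (π zero)) ⟩
    foldrFin (double n) (toggle (t₀ ∘ suc)) (inversionParity (τ ∘ suc))
      ≡⟨ cong (foldrFin (double n) (toggle (t₀ ∘ suc))) (inversionParity-suc (τ ∘ suc)) ⟩
    foldrFin (double n) (toggle (t₀ ∘ suc)) (foldrFin (double n) (toggle t₁) (inversionParity (doubleMap (V.tail π))))
      ≡⟨ cong (λ b → foldrFin (double n) (toggle (t₀ ∘ suc)) (foldrFin (double n) (toggle t₁) b))
              (inversionParity-doubleMap n (V.tail π) (FinP.suc-injective ∘ inj)) ⟩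
    foldrFin (double n) (toggle (t₀ ∘ suc)) (foldrFin (double n) (toggle t₁) false)
      ≡⟨ foldrFin-toggle-twice (double n) (t₀ ∘ suc) t₁ t₀∘suc≗t₁ ⟩
    false ∎
    where
    τ : Fin (double (suc n)) → Fin (double N)
    τ = doubleMap π
    t₀ : Fin (suc (double n)) → Bool
    t₀ j = ⌊ τ (suc j) <? τ zero ⌋
    t₁ : Fin (double n) → Bool
    t₁ j = ⌊ τ (suc (suc j)) <? τ (suc zero) ⌋
    rest : Bool
    rest = foldrFin (double n) (toggle (t₀ ∘ suc)) (inversionParity (τ ∘ suc))
    t₀∘suc≗t₁ : ∀ j → t₀ (suc j) ≡ t₁ j
    t₀∘suc≗t₁ j = <?-even≡<?-odd (τ (suc (suc j))) (π zero) (λ e → 0≢2+j (doubleMap-injective π inj (≡.sym e)))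
      where
      0≢2+j : Fin.zero ≢ suc (suc j)
      0≢2+j ()

module Coefficients {c ℓ} (F : Field c ℓ) where
  open Field F hiding (zero) renaming (refl to ≈-refl; sym to ≈-sym; trans to ≈-trans)
  open import Relation.Binary.Reasoning.Setoid setoid
  open Sums F
  open Inversions F

  Extensional : ∀ {m N} → ((Fin m → Fin N) → Carrier) → Set ℓ
  Extensional G = ∀ σ σ′ → (∀ i → σ i ≡ σ′ i) → G σ ≈ G σ′

  module _ {N : ℕ} where
    graph : ∀ {m} → (Fin m → Fin N) → (Fin m → Fin N) → List (MVar F N)
    graph r σ = tabulate (λ i → r i , σ i)

    indicator≈[≟W]* : ∀ (u w : List (MVar F N)) → indicator F u w ≈ [ _≟W_ F u w ]* 1#
    indicator≈[≟W]* u w with _≟W_ F u w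
    ... | yes _ = ≈-refl
    ... | no  _ = ≈-refl

    indicator-∷ : ∀ (i j a b : Fin N) u w →
      indicator F ((i , a) ∷ u) ((j , b) ∷ w) ≈ [ i FinP.≟ j ]* [ a FinP.≟ b ]* indicator F u w
    indicator-∷ i j a b u w = begin
      indicator F ((i , a) ∷ u) ((j , b) ∷ w)     ≈⟨ indicator≈[≟W]* ((i , a) ∷ u) ((j , b) ∷ w) ⟩
      [ _≟W_ F ((i , a) ∷ u) ((j , b) ∷ w) ]* 1#  ≈⟨ split (i FinP.≟ j) (a FinP.≟ b) (_≟W_ F u w) ⟩
      [ i FinP.≟ j ]* [ a FinP.≟ b ]* [ _≟W_ F u w ]* 1#
        ≈⟨ []*-cong (i FinP.≟ j) ([]*-cong (a FinP.≟ b) (≈-sym (indicator≈[≟W]* u w))) ⟩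
      [ i FinP.≟ j ]* [ a FinP.≟ b ]* indicator F u w ∎
      where
      split : (i? : Dec (i ≡ j)) (a? : Dec (a ≡ b)) (u? : Dec (u ≡ w)) →
        [ _≟W_ F ((i , a) ∷ u) ((j , b) ∷ w) ]* 1# ≈ [ i? ]* [ a? ]* [ u? ]* 1#
      split (yes refl) (yes refl) (yes refl) = []*-yes (_≟W_ F ((i , a) ∷ u) ((i , a) ∷ u)) refl
      split (yes refl) (yes refl) (no u≢w)   =
        []*-no (_≟W_ F ((i , a) ∷ u) ((i , a) ∷ w)) (u≢w ∘ ListP.∷-injectiveʳ)
      split (yes refl) (no a≢b)   _          =
        []*-no (_≟W_ F ((i , a) ∷ u) ((i , b) ∷ w)) (a≢b ∘ cong proj₂ ∘ ListP.∷-injectiveˡ)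
      split (no i≢j)   _          _          =
        []*-no (_≟W_ F ((i , a) ∷ u) ((j , b) ∷ w)) (i≢j ∘ cong proj₁ ∘ ListP.∷-injectiveˡ)

    -- readOff m r G w is G σ when w = (r 0 , σ 0) ⋯ (r (m-1) , σ (m-1)), and 0 otherwise.
    readOff : ∀ m → (Fin m → Fin N) → ((Fin m → Fin N) → Carrier) → List (MVar F N) → Carrier
    readOff zero    r G []            = G (λ ())
    readOff zero    r G (_ ∷ _)       = 0#
    readOff (suc m) r G []            = 0#
    readOff (suc m) r G ((a , b) ∷ w) = [ r zero FinP.≟ a ]* readOff m (V.tail r) (λ σ → G (b V.∷ σ)) w

    sum-indicator-graph : ∀ m (r : Fin m → Fin N) (G : (Fin m → Fin N) → Carrier) → Extensional G → ∀ w →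
      sum (map (λ σ → G σ * indicator F (graph r σ) w) (allFuns F m N)) ≈ readOff m r G w
    sum-indicator-graph zero    r G ext []      = ≈-trans (+-identityʳ _) (≈-trans (*-identityʳ _) (ext _ _ (λ ())))
    sum-indicator-graph zero    r G ext (_ ∷ _) = ≈-trans (+-identityʳ _) (zeroʳ _)
    sum-indicator-graph (suc m) r G ext []      = sum-map-zero (allFuns F (suc m) N) (λ _ → zeroʳ _)
    sum-indicator-graph (suc m) r G ext ((a , b) ∷ w) = begin
      sum (map (λ σ → G σ * indicator F (graph r σ) ((a , b) ∷ w)) (allFuns F (suc m) N))
        ≈⟨ sum-map-cong (allFuns F (suc m) N) (λ σ → ≈-trans
             (*-cong ≈-refl (indicator-∷ (r zero) a (σ zero) b (graph (V.tail r) (V.tail σ)) w))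
             (≈-trans (≈-sym ([]*-*ˡ r₀? _ _)) ([]*-cong r₀? (≈-sym ([]*-*ˡ (σ zero FinP.≟ b) _ _))))) ⟩
      sum (map (λ σ → [ r₀? ]* [ σ zero FinP.≟ b ]* (G σ * indicator F (graph (V.tail r) (V.tail σ)) w))
               (allFuns F (suc m) N))
        -- σ = j ∷ f, and only j = b survives
        ≈⟨ ≈-trans (sum-concatMap _ _ (allFuns F m N)) (sum-map-cong (allFuns F m N) λ f →
             ≈-trans (sum-map-∘ (allFin N) (λ _ → refl)) (≈-trans (sum-map-[]* r₀? _ (allFin N))
             ([]*-cong r₀? (≈-trans (sumFin-[≟]*ˡ N b _)
               (*-cong (ext _ _ (λ { zero → refl ; (suc i) → refl })) ≈-refl))))) ⟩
      sum (map (λ f → [ r₀? ]* Gᵇ f) (allFuns F m N))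
        ≈⟨ sum-map-[]* r₀? Gᵇ (allFuns F m N) ⟩
      [ r₀? ]* sum (map Gᵇ (allFuns F m N))
        ≈⟨ []*-cong r₀? (sum-indicator-graph m (V.tail r) (λ f → G (b V.∷ f)) ext-tail w) ⟩
      readOff (suc m) r G ((a , b) ∷ w) ∎
      where
      r₀? : Dec (r zero ≡ a)
      r₀? = r zero FinP.≟ a
      Gᵇ : (Fin m → Fin N) → Carrier
      Gᵇ f = G (b V.∷ f) * indicator F (graph (V.tail r) f) w
      ext-tail : Extensional (λ f → G (b V.∷ f))
      ext-tail σ σ′ e = ext _ _ (λ { zero → refl ; (suc i) → e i })

  readOff-doubleWord : ∀ n {N} (r : Fin (double n) → Fin (double N)) (r′ : Fin n → Fin N) →
    (∀ j → r (even j) ≡ even (r′ j)) → (∀ j → r (odd j) ≡ odd (r′ j)) →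
    (G : (Fin (double n) → Fin (double N)) → Carrier) (G′ : (Fin n → Fin N) → Carrier) →
    Extensional G → (∀ π → G (doubleMap π) ≈ G′ π) →
    ∀ w → readOff (double n) r G (doubleWord w) ≈ readOff n r′ G′ w
  readOff-doubleWord zero    r r′ r-even r-odd G G′ ext G∘doubleMap []      =
    ≈-trans (ext _ _ (λ ())) (G∘doubleMap (λ ()))
  readOff-doubleWord zero    r r′ r-even r-odd G G′ ext G∘doubleMap (_ ∷ _) = ≈-refl
  readOff-doubleWord (suc n) r r′ r-even r-odd G G′ ext G∘doubleMap []      = ≈-refl
  readOff-doubleWord (suc n) r r′ r-even r-odd G G′ ext G∘doubleMap ((i , a) ∷ w) = begin
    [ r zero FinP.≟ even i ]* [ r (suc zero) FinP.≟ odd i ]* rest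
      ≈⟨ first-row (r zero) (r (suc zero)) (r-even zero) (r-odd zero) ⟩
    [ r′ zero FinP.≟ i ]* rest
      ≈⟨ []*-cong (r′ zero FinP.≟ i) (readOff-doubleWord n (V.tail (V.tail r)) (V.tail r′) (r-even ∘ suc)
           (r-odd ∘ suc) Gᵃ (λ f → G′ (a V.∷ f)) ext-tail
           (λ π → ≈-trans (ext _ _ tail-doubleMap) (G∘doubleMap (a V.∷ π))) w) ⟩
    [ r′ zero FinP.≟ i ]* readOff n (V.tail r′) (λ f → G′ (a V.∷ f)) w ∎
    where
    Gᵃ : (Fin (double n) → Fin (double _)) → Carrier
    Gᵃ f = G (even a V.∷ odd a V.∷ f)
    rest : Carrier
    rest = readOff (double n) (V.tail (V.tail r)) Gᵃ (doubleWord w)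
    ext-tail : Extensional Gᵃ
    ext-tail σ σ′ e = ext _ _ λ { zero → refl ; (suc zero) → refl ; (suc (suc x)) → e x }
    tail-doubleMap : ∀ {π} x → (even a V.∷ odd a V.∷ doubleMap π) x ≡ doubleMap (a V.∷ π) x
    tail-doubleMap zero          = refl
    tail-doubleMap (suc zero)    = refl
    tail-doubleMap (suc (suc x)) = refl
    first-row : ∀ x y → x ≡ even (r′ zero) → y ≡ odd (r′ zero) →
      [ x FinP.≟ even i ]* [ y FinP.≟ odd i ]* rest ≈ [ r′ zero FinP.≟ i ]* rest
    first-row x y refl refl with r′ zero FinP.≟ i
    ... | yes refl = ≈-trans ([]*-yes (even (r′ zero) FinP.≟ even i) refl) ([]*-yes (odd (r′ zero) FinP.≟ odd i) refl)
    ... | no r′₀≢i = []*-no (even (r′ zero) FinP.≟ even i) (r′₀≢i ∘ even-injective)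

  detWeight permWeight : ∀ {m} → (Fin m → Fin m) → Carrier
  detWeight σ = if isPerm F σ then sgn F σ else 0#
  permWeight σ = if isPerm F σ then 1# else 0#

  detWeight-extensional : ∀ {m} → Extensional (detWeight {m})
  detWeight-extensional σ σ′ e = reflexive (cong₂ (λ b o → if b then (if o then - 1# else 1#) else 0#)
    (≡.trans (isPerm≡allDistinct σ) (≡.trans (allDistinct-cong e) (≡.sym (isPerm≡allDistinct σ′))))
    (≡.trans (oddPerm≡inversionParity σ) (≡.trans (inversionParity-cong e) (≡.sym (oddPerm≡inversionParity σ′)))))

  permWeight-extensional : ∀ {m} → Extensional (permWeight {m})
  permWeight-extensional σ σ′ e = reflexive (cong (λ b → if b then 1# else 0#)
    (≡.trans (isPerm≡allDistinct σ) (≡.trans (allDistinct-cong e) (≡.sym (isPerm≡allDistinct σ′)))))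

  isPerm-doubleMap : ∀ {n} (π : Fin n → Fin n) → isPerm F (doubleMap π) ≡ isPerm F π
  isPerm-doubleMap π =
    ≡.trans (isPerm≡allDistinct (doubleMap π)) (≡.trans (allDistinct-doubleMap π) (≡.sym (isPerm≡allDistinct π)))

  detWeight-doubleMap : ∀ n (π : Fin n → Fin n) → detWeight (doubleMap π) ≈ permWeight π
  detWeight-doubleMap n π with isPerm F π in π-perm
  ... | true  = reflexive (cong₂ (λ b o → if b then (if o then - 1# else 1#) else 0#)
                  (≡.trans (isPerm-doubleMap π) π-perm)
                  (≡.trans (oddPerm≡inversionParity (doubleMap π)) (inversionParity-doubleMap n π
                    (allDistinct⇒injective n π (≡.trans (≡.sym (isPerm≡allDistinct π)) π-perm)))))
  ... | false = reflexive (cong (λ b → if b then sgn F (doubleMap π) else 0#) (≡.trans (isPerm-doubleMap π) π-perm))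

  module _ {m : ℕ} where
    monomial≡graph : (σ : Fin m → Fin m) → monomial F σ ≡ graph (λ i → i) σ
    monomial≡graph σ = ListP.map-tabulate (λ i → i) (λ i → i , σ i)

    Cdet≈sum : ∀ w → Cdet F m w ≈ sum (map (λ σ → detWeight σ * indicator F (graph (λ i → i) σ) w) (allFuns F m m))
    Cdet≈sum w = sum-map-cong (allFuns F m m) term
      where
      term : ∀ σ → (if isPerm F σ then sgn F σ * indicator F (monomial F σ) w else 0#) ≈
                   detWeight σ * indicator F (graph (λ i → i) σ) w
      term σ with isPerm F σ
      ... | true  = *-cong ≈-refl (reflexive (cong (λ u → indicator F u w) (monomial≡graph σ)))
      ... | false = ≈-sym (zeroˡ _)

    Cperm≈sum : ∀ w → Cperm F m w ≈ sum (map (λ σ → permWeight σ * indicator F (graph (λ i → i) σ) w) (allFuns F m m))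
    Cperm≈sum w = sum-map-cong (allFuns F m m) term
      where
      term : ∀ σ → (if isPerm F σ then indicator F (monomial F σ) w else 0#) ≈
                   permWeight σ * indicator F (graph (λ i → i) σ) w
      term σ with isPerm F σ
      ... | true  = ≈-trans (reflexive (cong (λ u → indicator F u w) (monomial≡graph σ))) (≈-sym (*-identityˡ _))
      ... | false = ≈-sym (zeroˡ _)

  Cdet-doubleWord : ∀ n w → Cdet F (double n) (doubleWord w) ≈ Cperm F n w
  Cdet-doubleWord n w = begin
    Cdet F (double n) (doubleWord w)          ≈⟨ Cdet≈sum (doubleWord w) ⟩
    _ ≈⟨ sum-indicator-graph (double n) (λ i → i) detWeight detWeight-extensional (doubleWord w) ⟩
    readOff (double n) (λ i → i) detWeight (doubleWord w)
      ≈⟨ readOff-doubleWord n (λ i → i) (λ i → i) (λ _ → refl) (λ _ → refl) detWeight permWeight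
           detWeight-extensional (detWeight-doubleMap n) w ⟩
    readOff n (λ i → i) permWeight w
      ≈⟨ ≈-sym (sum-indicator-graph n (λ i → i) permWeight permWeight-extensional w) ⟩
    _                                         ≈⟨ ≈-sym (Cperm≈sum w) ⟩
    Cperm F n w                               ∎

-- States of the automaton that reads x_{2i,2a} x_{2i+1,2a+1} as the letter y_{ia};
-- half i a is the state between the two halves.
data State (n : ℕ) : Set where
  idle : State n
  half : Fin n → Fin n → State n

allStates : ∀ n → List (State n)
allStates n = idle ∷ concatMap (λ i → map (half i) (allFin n)) (allFin n)

module Projection {c ℓ} (F : Field c ℓ) (n : ℕ) where
  open Field F hiding (zero) renaming (refl to ≈-refl; sym to ≈-sym; trans to ≈-trans)
  open import Relation.Binary.Reasoning.Setoid setoid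
  open Sums F
  open NCPolynomials F

  X Y : Set
  X = MVar F (double n)
  Y = MVar F n

  _≟_ : (i j : Fin n) → Dec (i ≡ j)
  _≟_ = FinP._≟_

  -- project s t f w is the coefficient in f of the X-word on which the automaton goes from s to t emitting w
  -- (0 if there is none); in particular project idle idle f = f ∘ doubleWord.
  project₀ : State n → State n → NCPoly F X → Carrier
  project₀ idle       idle       f = f []
  project₀ idle       (half i a) f = f ((even i , even a) ∷ [])
  project₀ (half j c) idle       f = 0#
  project₀ (half j c) (half i a) f = [ i ≟ j ]* [ a ≟ c ]* f []

  project : State n → State n → NCPoly F X → NCPoly F Y
  project s          t f []            = project₀ s t f
  project idle       t f ((i , a) ∷ w) = project idle t (∂ (odd i , odd a) (∂ (even i , even a) f)) w
  project (half j c) t f ((i , a) ∷ w) = [ i ≟ j ]* [ a ≟ c ]* project idle t (∂ (odd i , odd a) f) w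

  project-idle : ∀ w f → project idle idle f w ≡ f (doubleWord w)
  project-idle []      f = refl
  project-idle (_ ∷ w) f = project-idle w _

  project-cong : ∀ s t w {f g} → _≈P_ F f g → project s t f w ≈ project s t g w
  project-cong idle       idle       []      f≈g = f≈g []
  project-cong idle       (half i a) []      f≈g = f≈g _
  project-cong (half j c) idle       []      f≈g = ≈-refl
  project-cong (half j c) (half i a) []      f≈g = []*-cong (i ≟ j) ([]*-cong (a ≟ c) (f≈g []))
  project-cong idle       t          (_ ∷ w) f≈g = project-cong idle t w (λ _ → f≈g _)
  project-cong (half j c) t ((i , a) ∷ w) f≈g =
    []*-cong (i ≟ j) ([]*-cong (a ≟ c) (project-cong idle t w (λ _ → f≈g _)))

  project-zero : ∀ s t w {f} → (∀ u → f u ≈ 0#) → project s t f w ≈ 0#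
  project-zero idle       idle       []      f≈0 = f≈0 []
  project-zero idle       (half i a) []      f≈0 = f≈0 _
  project-zero (half j c) idle       []      f≈0 = ≈-refl
  project-zero (half j c) (half i a) []      f≈0 = []*-zero (i ≟ j) ([]*-zero (a ≟ c) (f≈0 []))
  project-zero idle       t          (_ ∷ w) f≈0 = project-zero idle t w (λ _ → f≈0 _)
  project-zero (half j c) t ((i , a) ∷ w) f≈0 =
    []*-zero (i ≟ j) ([]*-zero (a ≟ c) (project-zero idle t w (λ _ → f≈0 _)))

  project-⊕ : ∀ s t w f g → project s t (f ⊕ g) w ≈ project s t f w + project s t g w
  project-⊕ idle       idle       []      f g = ≈-refl
  project-⊕ idle       (half i a) []      f g = ≈-refl
  project-⊕ (half j c) idle       []      f g = ≈-sym (+-identityˡ 0#)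
  project-⊕ (half j c) (half i a) []      f g =
    ≈-trans ([]*-cong (i ≟ j) ([]*-+ (a ≟ c) _ _)) ([]*-+ (i ≟ j) _ _)
  project-⊕ idle       t          (_ ∷ w) f g = project-⊕ idle t w _ _
  project-⊕ (half j c) t ((i , a) ∷ w) f g = ≈-trans
    ([]*-cong (i ≟ j) (≈-trans ([]*-cong (a ≟ c) (project-⊕ idle t w _ _)) ([]*-+ (a ≟ c) _ _)))
    ([]*-+ (i ≟ j) _ _)

  project-· : ∀ s t w k f → project s t (k · f) w ≈ k * project s t f w
  project-· idle       idle       []      k f = ≈-refl
  project-· idle       (half i a) []      k f = ≈-refl
  project-· (half j c) idle       []      k f = ≈-sym (zeroʳ k)
  project-· (half j c) (half i a) []      k f =
    ≈-trans ([]*-cong (i ≟ j) ([]*-*ˡ (a ≟ c) _ _)) ([]*-*ˡ (i ≟ j) _ _)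
  project-· idle       t          (_ ∷ w) k f = project-· idle t w k _
  project-· (half j c) t ((i , a) ∷ w) k f = ≈-trans
    ([]*-cong (i ≟ j) (≈-trans ([]*-cong (a ≟ c) (project-· idle t w k _)) ([]*-*ˡ (a ≟ c) _ _)))
    ([]*-*ˡ (i ≟ j) _ _)

  sumStates : (State n → Carrier) → Carrier
  sumStates h = sum (map h (allStates n))

  sumStates-split : ∀ h → sumStates h ≈ h idle + sumFin n (λ j → sumFin n (λ c → h (half j c)))
  sumStates-split h = +-cong ≈-refl (≈-trans (sum-concatMap h _ (allFin n))
    (sum-map-cong (allFin n) (λ j → sum-map-∘ (allFin n) (λ _ → refl))))

  projectProduct : State n → State n → NCPoly F X → NCPoly F X → NCPoly F Y
  projectProduct s t f g w = sumStates (λ r → (project s r f ⊗ project r t g) w)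

  projectProduct-[] : ∀ s t f g → projectProduct s t f g [] ≈
    project₀ s idle f * project₀ idle t g + sumFin n (λ j → sumFin n (λ c → project₀ s (half j c) f * project₀ (half j c) t g))
  projectProduct-[] s t f g =
    ≈-trans (sum-map-cong (allStates n) (λ r → ⊗-[] (project s r f) (project r t g))) (sumStates-split _)

  projectProduct-∷ : ∀ s t f g y w → projectProduct s t f g (y ∷ w) ≈
    (project₀ s idle f * project idle t g (y ∷ w)
      + sumFin n (λ j → sumFin n (λ c → project₀ s (half j c) f * project (half j c) t g (y ∷ w))))
    + sumStates (λ r → (∂ y (project s r f) ⊗ project r t g) w)
  projectProduct-∷ s t f g y w = ≈-trans
    (sum-map-cong (allStates n) (λ r → ⊗-∷ (project s r f) (project r t g) y w))
    (≈-trans (sum-map-+ (λ r → project₀ s r f * project r t g (y ∷ w)) (λ r → (∂ y (project s r f) ⊗ project r t g) w)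
                        (allStates n))
             (+-cong (sumStates-split _) ≈-refl))

  []*²-*ˡ : ∀ (i j a c : Fin n) k h → [ i ≟ j ]* [ a ≟ c ]* (k * h) ≈ k * [ i ≟ j ]* [ a ≟ c ]* h
  []*²-*ˡ i j a c k h = ≈-trans ([]*-cong (i ≟ j) ([]*-*ˡ (a ≟ c) k h)) ([]*-*ˡ (i ≟ j) k _)

  []*²-*ʳ : ∀ (i j a c : Fin n) h k → [ i ≟ j ]* [ a ≟ c ]* (h * k) ≈ ([ i ≟ j ]* [ a ≟ c ]* h) * k
  []*²-*ʳ i j a c h k = ≈-trans ([]*-cong (i ≟ j) ([]*-*ʳ (a ≟ c) h k)) ([]*-*ʳ (i ≟ j) _ k)

  project-⊗-[] : ∀ s t f g → project s t (f ⊗ g) [] ≈ projectProduct s t f g []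
  project-⊗-[] idle idle f g = begin
    (f ⊗ g) []                ≈⟨ ⊗-[] f g ⟩
    f [] * g []               ≈⟨ ≈-sym (+-identityʳ _) ⟩
    f [] * g [] + 0#          ≈⟨ +-cong ≈-refl (≈-sym (sumFin²-zero n _ (λ j c → zeroʳ _))) ⟩
    _                         ≈⟨ ≈-sym (projectProduct-[] idle idle f g) ⟩
    projectProduct idle idle f g [] ∎
  project-⊗-[] idle (half i a) f g = begin
    (f ⊗ g) (xe ∷ [])                     ≈⟨ ⊗-∷ f g xe [] ⟩
    f [] * g (xe ∷ []) + (∂ xe f ⊗ g) []  ≈⟨ +-cong ≈-refl (⊗-[] (∂ xe f) g) ⟩
    f [] * g (xe ∷ []) + f (xe ∷ []) * g []
      ≈⟨ +-cong ≈-refl (≈-sym (sumFin²-[≟]*ʳ n i a (λ j c → f ((even j , even c) ∷ []) * g []))) ⟩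
    _ ≈⟨ +-cong ≈-refl (sum-map-cong (allFin n) (λ j → sum-map-cong (allFin n) (λ c → []*²-*ˡ i j a c _ _))) ⟩
    _ ≈⟨ ≈-sym (projectProduct-[] idle (half i a) f g) ⟩
    projectProduct idle (half i a) f g [] ∎
    where
    xe : X
    xe = (even i , even a)
  project-⊗-[] (half j c) idle f g = begin
    0#      ≈⟨ ≈-sym (+-identityʳ 0#) ⟩
    0# + 0# ≈⟨ +-cong (≈-sym (zeroˡ _)) (≈-sym (sumFin²-zero n _ (λ j c → zeroʳ _))) ⟩
    _       ≈⟨ ≈-sym (projectProduct-[] (half j c) idle f g) ⟩
    projectProduct (half j c) idle f g [] ∎
  project-⊗-[] (half j c) (half i a) f g = begin
    [ i ≟ j ]* [ a ≟ c ]* (f ⊗ g) []      ≈⟨ []*-cong (i ≟ j) ([]*-cong (a ≟ c) (⊗-[] f g)) ⟩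
    [ i ≟ j ]* [ a ≟ c ]* (f [] * g [])   ≈⟨ []*²-*ˡ i j a c (f []) (g []) ⟩
    f [] * [ i ≟ j ]* [ a ≟ c ]* g []
      ≈⟨ ≈-sym (sumFin²-[≟]*ˡ n j c (λ j′ c′ → f [] * [ i ≟ j′ ]* [ a ≟ c′ ]* g [])) ⟩
    _ ≈⟨ sum-map-cong (allFin n) (λ j′ → sum-map-cong (allFin n) (λ c′ → []*²-*ʳ j′ j c′ c _ _)) ⟩
    _ ≈⟨ ≈-sym (+-identityˡ _) ⟩
    0# + _ ≈⟨ +-cong (≈-sym (zeroˡ _)) ≈-refl ⟩
    _ ≈⟨ ≈-sym (projectProduct-[] (half j c) (half i a) f g) ⟩
    projectProduct (half j c) (half i a) f g [] ∎

  project-⊗-idle : ∀ w t f g → project idle t (f ⊗ g) w ≈ projectProduct idle t f g w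
  project-⊗-idle []            t f g = project-⊗-[] idle t f g
  project-⊗-idle ((i , a) ∷ w) t f g = begin
    project idle t (∂² (f ⊗ g)) w
      ≈⟨ project-cong idle t w ∂²-⊗ ⟩
    project idle t (f [] · ∂² g ⊕ (f (xe ∷ []) · ∂ xo g ⊕ ∂² f ⊗ g)) w
      ≈⟨ ≈-trans (project-⊕ idle t w _ _) (+-cong (project-· idle t w _ _) (≈-trans (project-⊕ idle t w _ _)
           (+-cong (project-· idle t w _ _) (project-⊗-idle w t (∂² f) g)))) ⟩
    f [] * project idle t (∂² g) w + (f (xe ∷ []) * project idle t (∂ xo g) w + projectProduct idle t (∂² f) g w)
      ≈⟨ ≈-sym (+-assoc _ _ _) ⟩
    (f [] * project idle t (∂² g) w + f (xe ∷ []) * project idle t (∂ xo g) w) + projectProduct idle t (∂² f) g w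
      ≈⟨ +-cong (+-cong ≈-refl (≈-sym
           (sumFin²-[≟]*ʳ n i a (λ j c → f ((even j , even c) ∷ []) * project idle t (∂ xo g) w)))) ≈-refl ⟩
    _ ≈⟨ +-cong (+-cong ≈-refl
           (sum-map-cong (allFin n) (λ j → sum-map-cong (allFin n) (λ c → []*²-*ˡ i j a c _ _)))) ≈-refl ⟩
    _ ≈⟨ ≈-sym (projectProduct-∷ idle t f g (i , a) w) ⟩
    projectProduct idle t f g ((i , a) ∷ w) ∎
    where
    xe xo : X
    xe = (even i , even a)
    xo = (odd i , odd a)
    ∂² : NCPoly F X → NCPoly F X
    ∂² h = ∂ xo (∂ xe h)
    ∂²-⊗ : _≈P_ F (∂² (f ⊗ g)) (f [] · ∂² g ⊕ (f (xe ∷ []) · ∂ xo g ⊕ ∂² f ⊗ g))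
    ∂²-⊗ u = ≈-trans (⊗-∷ f g xe (xo ∷ u)) (+-cong ≈-refl (⊗-∷ (∂ xe f) g xo u))

  project-⊗ : ∀ w s t f g → project s t (f ⊗ g) w ≈ projectProduct s t f g w
  project-⊗ w             idle       t f g = project-⊗-idle w t f g
  project-⊗ []            (half j c) t f g = project-⊗-[] (half j c) t f g
  project-⊗ ((i , a) ∷ w) (half j c) t f g = begin
    [ i ≟ j ]* [ a ≟ c ]* project idle t (∂ xo (f ⊗ g)) w
      ≈⟨ []*-cong (i ≟ j) ([]*-cong (a ≟ c) ∂-⊗) ⟩
    [ i ≟ j ]* [ a ≟ c ]* (f [] * project idle t (∂ xo g) w + projectProduct idle t (∂ xo f) g w)
      ≈⟨ ≈-trans ([]*-cong (i ≟ j) ([]*-+ (a ≟ c) _ _)) ([]*-+ (i ≟ j) _ _) ⟩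
    [ i ≟ j ]* [ a ≟ c ]* (f [] * project idle t (∂ xo g) w)
      + [ i ≟ j ]* [ a ≟ c ]* projectProduct idle t (∂ xo f) g w
      ≈⟨ +-cong boundary-terms inner-terms ⟩
    _ ≈⟨ ≈-sym (projectProduct-∷ (half j c) t f g (i , a) w) ⟩
    projectProduct (half j c) t f g ((i , a) ∷ w) ∎
    where
    xo : X
    xo = (odd i , odd a)
    ∂-⊗ : project idle t (∂ xo (f ⊗ g)) w ≈ f [] * project idle t (∂ xo g) w + projectProduct idle t (∂ xo f) g w
    ∂-⊗ = ≈-trans (project-cong idle t w (⊗-∷ f g xo))
      (≈-trans (project-⊕ idle t w (f [] · ∂ xo g) (∂ xo f ⊗ g))
               (+-cong (project-· idle t w _ _) (project-⊗-idle w t (∂ xo f) g)))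
    boundary-terms : [ i ≟ j ]* [ a ≟ c ]* (f [] * project idle t (∂ xo g) w) ≈
      project₀ (half j c) idle f * project idle t g ((i , a) ∷ w)
        + sumFin n (λ j′ → sumFin n (λ c′ → project₀ (half j c) (half j′ c′) f * project (half j′ c′) t g ((i , a) ∷ w)))
    boundary-terms = begin
      _ ≈⟨ []*²-*ˡ i j a c (f []) _ ⟩
      f [] * [ i ≟ j ]* [ a ≟ c ]* project idle t (∂ xo g) w
        ≈⟨ ≈-sym (sumFin²-[≟]*ˡ n j c (λ j′ c′ → f [] * [ i ≟ j′ ]* [ a ≟ c′ ]* project idle t (∂ xo g) w)) ⟩
      _ ≈⟨ sum-map-cong (allFin n) (λ j′ → sum-map-cong (allFin n) (λ c′ → []*²-*ʳ j′ j c′ c _ _)) ⟩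
      _ ≈⟨ ≈-sym (+-identityˡ _) ⟩
      0# + _ ≈⟨ +-cong (≈-sym (zeroˡ _)) ≈-refl ⟩
      _ ∎
    inner-terms : [ i ≟ j ]* [ a ≟ c ]* projectProduct idle t (∂ xo f) g w ≈
      sumStates (λ r → (∂ (i , a) (project (half j c) r f) ⊗ project r t g) w)
    inner-terms = ≈-sym (begin
      sumStates (λ r → (∂ (i , a) (project (half j c) r f) ⊗ project r t g) w)
        ≈⟨ sum-map-cong (allStates n) (λ r → ≈-trans (⊗-[]*ˡ (i ≟ j) _ (project r t g) w)
             ([]*-cong (i ≟ j) (⊗-[]*ˡ (a ≟ c) _ (project r t g) w))) ⟩
      _ ≈⟨ sum-map-[]* (i ≟ j) _ (allStates n) ⟩
      _ ≈⟨ []*-cong (i ≟ j) (sum-map-[]* (a ≟ c) _ (allStates n)) ⟩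
      _ ∎)

module CircuitExtension {c ℓ} (F : Field c ℓ) {V : Set} (_≟_ : DecidableEquality V) where
  open Field F hiding (zero) renaming (refl to ≈-refl; sym to ≈-sym; trans to ≈-trans)
  open Sums F
  open NCPolynomials F

  val : ∀ {k} → Nodes F V k → Fin k → NCPoly F V
  val = nodeVal F _≟_

  infix 4 _≼_
  data _≼_ : ∀ {k k′} → Nodes F V k → Nodes F V k′ → Set c where
    ≼-refl : ∀ {k} {ns : Nodes F V k} → ns ≼ ns
    ≼-step : ∀ {k k′} {ns : Nodes F V k} {ns′ : Nodes F V k′} {g} → ns ≼ ns′ → ns ≼ (ns′ ▷ g)

  ≼-trans : ∀ {k₁ k₂ k₃} {ns₁ : Nodes F V k₁} {ns₂ : Nodes F V k₂} {ns₃ : Nodes F V k₃} →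
    ns₁ ≼ ns₂ → ns₂ ≼ ns₃ → ns₁ ≼ ns₃
  ≼-trans e ≼-refl     = e
  ≼-trans e (≼-step e′) = ≼-step (≼-trans e e′)

  lift : ∀ {k k′} {ns : Nodes F V k} {ns′ : Nodes F V k′} → ns ≼ ns′ → Fin k → Fin k′
  lift ≼-refl     i = i
  lift (≼-step e) i = suc (lift e i)

  val-lift : ∀ {k k′} {ns : Nodes F V k} {ns′ : Nodes F V k′} (e : ns ≼ ns′) i → val ns′ (lift e i) ≡ val ns i
  val-lift ≼-refl     i = refl
  val-lift (≼-step e) i = val-lift e i

  Computes : ∀ {k} → Nodes F V k → Fin k → NCPoly F V → Set ℓ
  Computes ns i f = _≈P_ F (val ns i) f

  HasNode : NCPoly F V → ∀ {k} → Nodes F V k → Set ℓ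
  HasNode f {k} ns = Σ (Fin k) λ i → Computes ns i f

  Computes-lift : ∀ {f k k′} {ns : Nodes F V k} {ns′ : Nodes F V k′} (e : ns ≼ ns′) {i} →
    Computes ns i f → Computes ns′ (lift e i) f
  Computes-lift e {i} comp w = ≡.subst (λ g → g w ≈ _) (≡.sym (val-lift e i)) (comp w)

  HasNode-lift : ∀ {f k k′} {ns : Nodes F V k} {ns′ : Nodes F V k′} → ns ≼ ns′ → HasNode f ns → HasNode f ns′
  HasNode-lift e (i , comp) = lift e i , Computes-lift e comp

  record Extension {k} (ns : Nodes F V k) (B : ℕ) (P : ∀ {k′} → Nodes F V k′ → Set ℓ) : Set (c ⊔ ℓ) where
    constructor extension
    field
      {size}  : ℕ
      nodes   : Nodes F V size
      extends : ns ≼ nodes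
      bounded : size ≤ B ℕ.+ k
      holds   : P nodes

  Extension-map : ∀ {k} {ns : Nodes F V k} {B} {P Q : ∀ {k′} → Nodes F V k′ → Set ℓ} →
    (∀ {k′} {ns′ : Nodes F V k′} → P ns′ → Q ns′) → Extension ns B P → Extension ns B Q
  Extension-map f (extension ns′ e b p) = extension ns′ e b (f p)

  extend-gate : ∀ {k} (ns : Nodes F V k) B (g : Gate F V k) {f} →
    _≈P_ F (gateVal F _≟_ ns g) f → Extension ns (suc B) (HasNode f)
  extend-gate {k} ns B g comp = extension (ns ▷ g) (≼-step ≼-refl) (s≤s (ℕP.m≤n+m k B)) (zero , comp)

  sumOfProducts : ∀ {A : Set} → List A → (A → NCPoly F V) → (A → NCPoly F V) → NCPoly F V
  sumOfProducts as P R w = sum (map (λ a → (P a ⊗ R a) w) as)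

  extend-sumOfProducts : ∀ {A : Set} (as : List A) (P R : A → NCPoly F V) {k₀} {ns₀ : Nodes F V k₀}
    (l r : A → Fin k₀) → (∀ a → Computes ns₀ (l a) (P a)) → (∀ a → Computes ns₀ (r a) (R a)) →
    ∀ {k} (ns : Nodes F V k) → ns₀ ≼ ns → Extension ns (suc (List.length as ℕ.* 2)) (HasNode (sumOfProducts as P R))
  extend-sumOfProducts [] P R l r l-comp r-comp ns e = extend-gate ns 0 (const 0#) λ { [] → ≈-refl ; (_ ∷ _) → ≈-refl }
  extend-sumOfProducts (a ∷ as) P R {ns₀ = ns₀} l r l-comp r-comp ns e
    with extend-sumOfProducts as P R l r l-comp r-comp ns e
  ... | extension ns₁ e₁ b₁ (i₁ , comp₁) =
    extension ((ns₁ ▷ mul (lift e′ (l a)) (lift e′ (r a))) ▷ add zero (suc i₁))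
              (≼-step (≼-step e₁)) (s≤s (s≤s b₁))
      (zero , λ w → +-cong (⊗-cong (Computes-lift e′ (l-comp a)) (Computes-lift e′ (r-comp a)) w) (comp₁ w))
    where
    e′ : ns₀ ≼ ns₁
    e′ = ≼-trans e e₁

  extend-forAll : ∀ {A : Set} (as : List A) (P : A → ∀ {k} → Nodes F V k → Set ℓ) (B : ℕ)
    {k₀} {ns₀ : Nodes F V k₀} →
    (∀ a {k} (ns : Nodes F V k) → ns₀ ≼ ns → Extension ns B (P a)) →
    (∀ a {k k′} {ns : Nodes F V k} {ns′ : Nodes F V k′} → ns ≼ ns′ → P a ns → P a ns′) →
    ∀ {k} (ns : Nodes F V k) → ns₀ ≼ ns → Extension ns (List.length as ℕ.* B) (λ ns′ → ∀ a → a ∈ as → P a ns′)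
  extend-forAll []       P B step mono ns e = extension ns ≼-refl ℕP.≤-refl (λ _ ())
  extend-forAll (a ∷ as) P B step mono {k} ns e with step a ns e
  ... | extension {k₁} ns₁ e₁ b₁ p₁ with extend-forAll as P B step mono ns₁ (≼-trans e e₁)
  ... | extension {k₂} ns₂ e₂ b₂ p₂ = extension ns₂ (≼-trans e₁ e₂) bound all-a
    where
    bound : k₂ ≤ (B ℕ.+ List.length as ℕ.* B) ℕ.+ k
    bound = ℕP.≤-trans b₂ (ℕP.≤-trans (ℕP.+-monoʳ-≤ (List.length as ℕ.* B) b₁) (ℕP.≤-reflexive
      (≡.trans (≡.sym (ℕP.+-assoc (List.length as ℕ.* B) B k))
               (cong (ℕ._+ k) (ℕP.+-comm (List.length as ℕ.* B) B)))))
    all-a : ∀ a′ → a′ ∈ a ∷ as → P a′ ns₂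
    all-a a′ (here refl) = mono a e₂ p₁
    all-a a′ (there a′∈as) = p₂ a′ a′∈as

allStates-complete : ∀ n (s : State n) → s ∈ allStates n
allStates-complete n idle       = here refl
allStates-complete n (half i a) = there (∈P.∈-concatMap⁺ (λ j → map (half j) (allFin n))
  (Any.map (λ { refl → ∈P.∈-map⁺ (half i) (∈P.∈-allFin a) }) (∈P.∈-allFin i)))

length-concatMap : ∀ {A B : Set} (f : A → List B) k xs →
  (∀ x → List.length (f x) ≡ k) → List.length (concatMap f xs) ≡ List.length xs ℕ.* k
length-concatMap f k []       _   = refl
length-concatMap f k (x ∷ xs) len = ≡.trans (ListP.length-++ (f x)) (cong₂ ℕ._+_ (len x) (length-concatMap f k xs len))

length-allStates : ∀ n → List.length (allStates n) ≡ suc (n ℕ.* n)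
length-allStates n = cong suc (≡.trans
  (length-concatMap (λ j → map (half j) (allFin n)) n (allFin n)
    (λ j → ≡.trans (ListP.length-map (half j) (allFin n)) (ListP.length-tabulate (λ x → x))))
  (cong (ℕ._* n) (ListP.length-tabulate {n = n} (λ x → x))))

module Simulation {c ℓ} (F : Field c ℓ) (n : ℕ) where
  open Field F hiding (zero) renaming (refl to ≈-refl; sym to ≈-sym; trans to ≈-trans)
  open import Relation.Binary.Reasoning.Setoid setoid
  open Sums F
  open NCPolynomials F
  open Projection F n
  open CircuitExtension F (_≟V_ F {n})

  _≟X_ : DecidableEquality X
  _≟X_ = _≟V_ F

  varP-single : ∀ {m} (x y : MVar F m) → varP F (_≟V_ F) x (y ∷ []) ≡ [ _≟V_ F x y ]* 1#
  varP-single x y with _≟V_ F x y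
  ... | yes _ = refl
  ... | no  _ = refl

  -- Only the entry (half j c , idle) of the projection of x_{2j+1,2c+1} is not a constant: it is y_{jc}.
  varGate : ∀ {k} → State n → State n → X → Gate F Y k
  varGate idle       t          x = const (project₀ idle t (varP F _≟X_ x))
  varGate (half j c) idle       x with x ≟X (odd j , odd c)
  ... | yes _ = var (j , c)
  ... | no  _ = const 0#
  varGate (half j c) (half i a) x = const (project₀ (half j c) (half i a) (varP F _≟X_ x))

  odd-letter : ∀ (i j a c : Fin n) →
    [ _≟V_ F (j , c) (i , a) ]* 1# ≈ [ i ≟ j ]* [ a ≟ c ]* [ (odd j , odd c) ≟X (odd i , odd a) ]* 1#
  odd-letter i j a c with i ≟ j | a ≟ c
  ... | yes refl | yes refl = ≈-trans ([]*-yes (_≟V_ F (j , c) (j , c)) refl)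
                                      (≈-sym ([]*-yes ((odd j , odd c) ≟X (odd j , odd c)) refl))
  ... | no i≢j   | _        = []*-no (_≟V_ F (j , c) (i , a)) (i≢j ∘ ≡.sym ∘ cong proj₁)
  ... | yes _    | no a≢c   = []*-no (_≟V_ F (j , c) (i , a)) (a≢c ∘ ≡.sym ∘ cong proj₂)

  other-letter : ∀ (i j a c : Fin n) x → x ≢ (odd j , odd c) →
    0# ≈ [ i ≟ j ]* [ a ≟ c ]* [ x ≟X (odd i , odd a) ]* 1#
  other-letter i j a c x x≢ with i ≟ j | a ≟ c
  ... | yes refl | yes refl = ≈-sym ([]*-no (x ≟X (odd i , odd a)) x≢)
  ... | no _     | _        = ≈-refl
  ... | yes _    | no _     = ≈-refl

  varGate-correct : ∀ {k} (ns : Nodes F Y k) s t x →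
    _≈P_ F (gateVal F (_≟V_ F) ns (varGate s t x)) (project s t (varP F _≟X_ x))
  varGate-correct ns idle       idle       x []      = ≈-refl
  varGate-correct ns idle       (half i a) x []      = ≈-refl
  varGate-correct ns idle       t          x (_ ∷ w) = ≈-sym (project-zero idle t w (λ _ → ≈-refl))
  varGate-correct ns (half j c) (half i a) x []      = ≈-refl
  varGate-correct ns (half j c) (half i a) x ((i′ , a′) ∷ [])    = ≈-sym ([]*-zero (i′ ≟ j) ([]*-zero (a′ ≟ c) ≈-refl))
  varGate-correct ns (half j c) (half i a) x ((i′ , a′) ∷ _ ∷ w) =
    ≈-sym ([]*-zero (i′ ≟ j) ([]*-zero (a′ ≟ c) (project-zero idle (half i a) w (λ _ → ≈-refl))))
  varGate-correct ns (half j c) idle x w with x ≟X (odd j , odd c)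
  varGate-correct ns (half j c) idle x [] | yes _ = ≈-refl
  varGate-correct ns (half j c) idle x [] | no  _ = ≈-refl
  varGate-correct ns (half j c) idle x ((i′ , a′) ∷ []) | yes refl = begin
    varP F (_≟V_ F) (j , c) ((i′ , a′) ∷ [])          ≡⟨ varP-single (j , c) (i′ , a′) ⟩
    [ _≟V_ F (j , c) (i′ , a′) ]* 1#                  ≈⟨ odd-letter i′ j a′ c ⟩
    [ i′ ≟ j ]* [ a′ ≟ c ]* [ (odd j , odd c) ≟X (odd i′ , odd a′) ]* 1#
      ≡⟨ cong (λ v → [ i′ ≟ j ]* [ a′ ≟ c ]* v) (≡.sym (varP-single (odd j , odd c) (odd i′ , odd a′))) ⟩
    [ i′ ≟ j ]* [ a′ ≟ c ]* varP F _≟X_ (odd j , odd c) ((odd i′ , odd a′) ∷ []) ∎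
  varGate-correct ns (half j c) idle x ((i′ , a′) ∷ []) | no x≢ = begin
    0#                                                ≈⟨ other-letter i′ j a′ c x x≢ ⟩
    [ i′ ≟ j ]* [ a′ ≟ c ]* [ x ≟X (odd i′ , odd a′) ]* 1#
      ≡⟨ cong (λ v → [ i′ ≟ j ]* [ a′ ≟ c ]* v) (≡.sym (varP-single x (odd i′ , odd a′))) ⟩
    [ i′ ≟ j ]* [ a′ ≟ c ]* varP F _≟X_ x ((odd i′ , odd a′) ∷ []) ∎
  varGate-correct ns (half j c) idle x ((i′ , a′) ∷ _ ∷ w) | yes _ =
    ≈-sym ([]*-zero (i′ ≟ j) ([]*-zero (a′ ≟ c) (project-zero idle idle w (λ _ → ≈-refl))))
  varGate-correct ns (half j c) idle x ((i′ , a′) ∷ _ ∷ w) | no  _ =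
    ≈-sym ([]*-zero (i′ ≟ j) ([]*-zero (a′ ≟ c) (project-zero idle idle w (λ _ → ≈-refl))))

  constGate-correct : ∀ {k} (ns : Nodes F Y k) s t r →
    _≈P_ F (gateVal F (_≟V_ F) ns (const (project₀ s t (constP F r)))) (project s t (constP F r))
  constGate-correct ns s          t r []              = ≈-refl
  constGate-correct ns idle       t r (_ ∷ w)         = ≈-sym (project-zero idle t w (λ _ → ≈-refl))
  constGate-correct ns (half j c) t r ((i′ , a′) ∷ w) =
    ≈-sym ([]*-zero (i′ ≟ j) ([]*-zero (a′ ≟ c) (project-zero idle t w (λ _ → ≈-refl))))

  statesCount gateCost gatesPerGate : ℕ
  statesCount  = List.length (allStates n)
  gateCost     = suc (statesCount ℕ.* 2)
  gatesPerGate = statesCount ℕ.* (statesCount ℕ.* gateCost)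

  ProjectionTable : ∀ {k₀} → Nodes F X k₀ → ∀ {k} → Nodes F Y k → Set ℓ
  ProjectionTable {k₀} nsX ns = ∀ (i : Fin k₀) s t → HasNode (project s t (nodeVal F _≟X_ nsX i)) ns

  extend-projectEntry : ∀ {k₀} (nsX : Nodes F X k₀) (g : Gate F X k₀) {k′} {ns₀ : Nodes F Y k′} →
    ProjectionTable nsX ns₀ → ∀ s t {k} (ns : Nodes F Y k) → ns₀ ≼ ns →
    Extension ns gateCost (HasNode (project s t (gateVal F _≟X_ nsX g)))
  extend-projectEntry nsX (var x)   table s t ns e = extend-gate ns _ (varGate s t x) (varGate-correct ns s t x)
  extend-projectEntry nsX (const r) table s t ns e = extend-gate ns _ (const _) (constGate-correct ns s t r)
  extend-projectEntry nsX (add i j) table s t ns e with HasNode-lift e (table i s t) | HasNode-lift e (table j s t)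
  ... | (nᵢ , compᵢ) | (nⱼ , compⱼ) =
    extend-gate ns _ (add nᵢ nⱼ) (λ w → ≈-trans (+-cong (compᵢ w) (compⱼ w)) (≈-sym (project-⊕ s t w _ _)))
  extend-projectEntry nsX (mul i j) table s t ns e =
    Extension-map (λ (nᵢⱼ , comp) → nᵢⱼ , λ w → ≈-trans (comp w) (≈-sym (project-⊗ w s t _ _)))
      (extend-sumOfProducts (allStates n)
        (λ r → project s r (nodeVal F _≟X_ nsX i)) (λ r → project r t (nodeVal F _≟X_ nsX j))
        (λ r → proj₁ (table i s r)) (λ r → proj₁ (table j r t))
        (λ r → proj₂ (table i s r)) (λ r → proj₂ (table j r t)) ns e)

  extend-projectGate : ∀ {k₀} (nsX : Nodes F X k₀) (g : Gate F X k₀) {k} {ns₀ : Nodes F Y k} →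
    ProjectionTable nsX ns₀ →
    Extension ns₀ gatesPerGate
      (λ ns → ∀ s → s ∈ allStates n → ∀ t → t ∈ allStates n → HasNode (project s t (gateVal F _≟X_ nsX g)) ns)
  extend-projectGate nsX g table =
    extend-forAll (allStates n) (λ s ns → ∀ t → t ∈ allStates n → HasNode (project s t (gateVal F _≟X_ nsX g)) ns) _
      (λ s ns e → extend-forAll (allStates n) (λ t → HasNode (project s t (gateVal F _≟X_ nsX g))) gateCost
         (λ t ns′ e′ → extend-projectEntry nsX g table s t ns′ e′) (λ t e″ → HasNode-lift e″) ns e)
      (λ s e has t t∈ → HasNode-lift e (has t t∈)) _ ≼-refl

  simulate : ∀ {k₀} (nsX : Nodes F X k₀) → Extension [] (k₀ ℕ.* gatesPerGate) (ProjectionTable nsX)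
  simulate [] = extension [] ≼-refl z≤n (λ ())
  simulate {suc k₀} (nsX ▷ g) with simulate nsX
  ... | extension {k₁} ns₁ e₁ b₁ table₁ with extend-projectGate nsX g table₁
  ... | extension {k₂} ns₂ e₂ b₂ table₂ = extension ns₂ (≼-trans e₁ e₂) bound table
    where
    bound : k₂ ≤ (gatesPerGate ℕ.+ k₀ ℕ.* gatesPerGate) ℕ.+ 0
    bound = ℕP.≤-trans b₂ (ℕP.≤-trans (ℕP.+-monoʳ-≤ gatesPerGate b₁)
                                       (ℕP.≤-reflexive (≡.sym (ℕP.+-assoc gatesPerGate _ 0))))
    table : ProjectionTable (nsX ▷ g) ns₂
    table zero    s t = table₂ s (allStates-complete n s) t (allStates-complete n t)
    table (suc i) s t = HasNode-lift e₂ (table₁ i s t)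

open import Data.Nat using (_+_; _*_)

-- Each gate becomes (n² + 1)² entries of at most 2(n² + 1) + 1 gates: s (2n⁶ + 7n⁴ + 8n² + 3) in all.
sizeBound : Poly2
sizeBound = (3 , 1 , 0) ∷ (8 , 1 , 2) ∷ (7 , 1 , 4) ∷ (2 , 1 , 6) ∷ []

module Reduction {c ℓ} (F : Field c ℓ) where
  open Field F using (setoid)
  open import Relation.Binary.Reasoning.Setoid setoid
  open Coefficients F using (Cdet-doubleWord)
  open Simulation F using (gatesPerGate; simulate)

  CdetCircuit : ℕ → ℕ → Set (c ⊔ ℓ)
  CdetCircuit s m = Σ (Circuit F (MVar F m) s) λ C → computes F (_≟V_ F) C (Cdet F m)

  simulationSize≤sizeBound : ∀ n s → s * gatesPerGate n + 0 ≤ eval2 sizeBound s n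
  simulationSize≤sizeBound n s = ℕP.≤-reflexive
    (≡.trans (cong (λ q → s * (q * (q * suc (q * 2))) + 0) (length-allStates n)) (normalise s n))
    where
    normalise : ∀ s n → s * ((1 + n * n) * ((1 + n * n) * (1 + (1 + n * n) * 2))) + 0 ≡
      3 * (s * 1) * 1 + (8 * (s * 1) * (n * (n * 1)) + (7 * (s * 1) * (n * (n * (n * (n * 1))))
        + (2 * (s * 1) * (n * (n * (n * (n * (n * (n * 1)))))) + 0)))
    normalise = solve-∀

  cpermCircuit : ∀ n s → CdetCircuit s (double n) →
    Σ ℕ λ s′ → s′ ≤ eval2 sizeBound s n × Σ (Circuit F (MVar F n) s′) λ D → computes F (_≟V_ F) D (Cperm F n)
  cpermCircuit n s (circuit nsX out , nsX-computes) with simulate n nsX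
  ... | CircuitExtension.extension {s′} nsY _ bounded table with table out idle idle
  ... | out′ , out′-computes =
    s′ , ℕP.≤-trans bounded (simulationSize≤sizeBound n s) , circuit nsY out′ , λ w → begin
      nodeVal F (_≟V_ F) nsY out′ w                     ≈⟨ out′-computes w ⟩
      project idle idle (nodeVal F (_≟V_ F) nsX out) w  ≡⟨ project-idle w _ ⟩
      nodeVal F (_≟V_ F) nsX out (doubleWord w)         ≈⟨ nsX-computes (doubleWord w) ⟩
      Cdet F (double n) (doubleWord w)                  ≈⟨ Cdet-doubleWord n w ⟩
      Cperm F n w                                       ∎
    where open Projection F n using (project; project-idle)

theorem4p5 : ∀ {c ℓ} (F : Field c ℓ) →
    Σ Poly2 λ p → ∀ (n s : ℕ) →
      Σ (Circuit F (MVar F (2 * n)) s) (λ C → computes F (_≟V_ F) C (Cdet F (2 * n))) →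
      Σ ℕ λ s′ → s′ ≤ eval2 p s n ×
        Σ (Circuit F (MVar F n) s′) (λ D → computes F (_≟V_ F) D (Cperm F n))
theorem4p5 F = sizeBound , λ n s → Reduction.cpermCircuit F n s ∘ ≡.subst (Reduction.CdetCircuit F s) (double≡2* n)
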